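{- The sequent calculus $\mathtt{LSkT}$ is cut-free, i.e. the rule: from $U \vdash A$ and $T[A] \vdash C$ infer $T[U] \vdash C$ (for any trees $U$, context $T[\cdot]$, formulae $A,C$) is admissible.
   Context: Formulae are generated by $A,B ::= X \mid \mathsf{I} \mid A \otimes B \mid A \multimap B$, with $X$ ranging over a set of atoms. Trees are generated by $T ::= A \mid { - } \mid (T,T)$ where $A$ is a formula and ${ - }$ is the empty tree. Contexts (trees with one hole) are generated by $\mathcal{C} ::= [\cdot] \mid (\mathcal{C},T) \mid (T,\mathcal{C})$, and $T[U]$ denotes the tree obtained by substituting the tree $U$ for the hole of the context $T[\cdot]$. Sequents of $\mathtt{LSkT}$ have the form $T \vdash A$ with $T$ a tree and $A$ a formula. Derivations are generated by the rules: (ax) $A \vdash A$; (IL) from $T[{ - }] \vdash C$ infer $T[\mathsf{I}] \vdash C$; (IR) ${ - } \vdash \mathsf{I}$; ($\otimes$L) from $T[A,B] \vdash C$ infer $T[A\otimes B] \vdash C$; ($\otimes$R) from $T \vdash A$ and $U \vdash B$ infer $T,U \vdash A \otimes B$; ($\multimap$L) from $U \vdash A$ and $T[B] \vdash C$ infer $T[A\multimap B, U] \vdash C$; ($\multimap$R) from $T, A \vdash B$ infer $T \vdash A \multimap B$; (assoc) from $T[U_0,(U_1,U_2)] \vdash C$ infer $T[(U_0,U_1),U_2] \vdash C$; (unitL) from $T[U] \vdash C$ infer $T[{ - },U] \vdash C$; (unitR) from $T[U,{ - }] \vdash C$ infer $T[U] \vdash C$. -}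

module Defs where

module LSkT (At : Set) where

  infixr 25 _⊗_
  infixr 20 _⊸_

  data Fma : Set where
    ` : At → Fma
    I : Fma
    _⊗_ : Fma → Fma → Fma
    _⊸_ : Fma → Fma → Fma

  data Tree : Set where
    η : Fma → Tree
    ─ : Tree
    _,,_ : Tree → Tree → Tree

  data Ctx : Set where
    ∙ : Ctx
    _◂_ : Ctx → Tree → Ctx
    _▸_ : Tree → Ctx → Ctx

  _[_] : Ctx → Tree → Tree
  ∙ [ U ] = U
  (C ◂ T) [ U ] = (C [ U ]) ,, T
  (T ▸ C) [ U ] = T ,, (C [ U ])

  infix 5 _⊢_

  data _⊢_ : Tree → Fma → Set where
    ax : ∀ {A} → η A ⊢ A
    IL : ∀ {T C} → T [ ─ ] ⊢ C → T [ η I ] ⊢ C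
    IR : ─ ⊢ I
    ⊗L : ∀ {T A B C} → T [ η A ,, η B ] ⊢ C → T [ η (A ⊗ B) ] ⊢ C
    ⊗R : ∀ {T U A B} → T ⊢ A → U ⊢ B → T ,, U ⊢ A ⊗ B
    ⊸L : ∀ {T U A B C} → U ⊢ A → T [ η B ] ⊢ C → T [ η (A ⊸ B) ,, U ] ⊢ C
    ⊸R : ∀ {T A B} → T ,, η A ⊢ B → T ⊢ A ⊸ B
    assoc : ∀ {T U₀ U₁ U₂ C} → T [ U₀ ,, (U₁ ,, U₂) ] ⊢ C → T [ (U₀ ,, U₁) ,, U₂ ] ⊢ C
    unitL : ∀ {T U C} → T [ U ] ⊢ C → T [ ─ ,, U ] ⊢ C
    unitR : ∀ {T U C} → T [ U ,, ─ ] ⊢ C → T [ U ] ⊢ C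

{-# OPTIONS --safe #-}
module Submission where

open import Data.Product using (_×_; _,_)
open import Data.Unit using (⊤; tt)
open import Relation.Binary.PropositionalEquality using (_≡_; refl; sym; cong; subst)

open import Defs

-- Cut is eliminated by the usual nested induction: on the cut formula A, then on the left
-- premise, then on the right premise. If the left premise ends in a left or structural rule,
-- that rule acts on a subtree of U and therefore commutes with the cut. Otherwise it ends in
-- a right rule and the cut moves up the right premise: the active tree of the last rule there
-- either misses the occurrence of A, and again the rule commutes with the cut, or contains it.
-- In the latter case A is either principal, and the cut reduces to cuts on its immediate
-- subformulas, or lies inside a tree that the (structural or ⊸L) rule only moves around.

module CutAdmissibility (At : Set) where
  open LSkT At

  subst⊢ : ∀ {W W' C} → W ≡ W' → W ⊢ C → W' ⊢ C
  subst⊢ {C = C} = subst (_⊢ C)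

  ,,-injective : ∀ {T U T' U'} → (T ,, U) ≡ (T' ,, U') → T ≡ T' × U ≡ U'
  ,,-injective refl = refl , refl

  infixl 30 _⊚_
  _⊚_ : Ctx → Ctx → Ctx
  ∙ ⊚ K = K
  (T ◂ V) ⊚ K = (T ⊚ K) ◂ V
  (V ▸ T) ⊚ K = V ▸ (T ⊚ K)

  ⊚-[] : ∀ T K Z → (T ⊚ K) [ Z ] ≡ T [ K [ Z ] ]
  ⊚-[] ∙ K Z = refl
  ⊚-[] (T ◂ V) K Z = cong (_,, V) (⊚-[] T K Z)
  ⊚-[] (V ▸ T) K Z = cong (V ,,_) (⊚-[] T K Z)

  -- Contexts with two holes, numbered 1 and 2: in K₁ ,₁₂ K₂ hole 1 lies in the left subtree.
  data Ctx₂ : Set where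
    _◂₂_ : Ctx₂ → Tree → Ctx₂
    _▸₂_ : Tree → Ctx₂ → Ctx₂
    _,₁₂_ : Ctx → Ctx → Ctx₂
    _,₂₁_ : Ctx → Ctx → Ctx₂

  fill₁ : Ctx₂ → Tree → Ctx
  fill₁ (D ◂₂ V) X = fill₁ D X ◂ V
  fill₁ (V ▸₂ D) X = V ▸ fill₁ D X
  fill₁ (K₁ ,₁₂ K₂) X = (K₁ [ X ]) ▸ K₂
  fill₁ (K₂ ,₂₁ K₁) X = K₂ ◂ (K₁ [ X ])

  fill₂ : Ctx₂ → Tree → Ctx
  fill₂ (D ◂₂ V) Y = fill₂ D Y ◂ V
  fill₂ (V ▸₂ D) Y = V ▸ fill₂ D Y
  fill₂ (K₁ ,₁₂ K₂) Y = K₁ ◂ (K₂ [ Y ])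
  fill₂ (K₂ ,₂₁ K₁) Y = (K₂ [ Y ]) ▸ K₁

  fill-comm : ∀ D X Y → fill₂ D Y [ X ] ≡ fill₁ D X [ Y ]
  fill-comm (D ◂₂ V) X Y = cong (_,, V) (fill-comm D X Y)
  fill-comm (V ▸₂ D) X Y = cong (V ,,_) (fill-comm D X Y)
  fill-comm (K₁ ,₁₂ K₂) X Y = refl
  fill-comm (K₂ ,₂₁ K₁) X Y = refl

  data Overlap (T' : Ctx) (X : Tree) (T : Ctx) (A : Fma) : Set where
    disjoint : (D : Ctx₂) → T' ≡ fill₂ D (η A) → T ≡ fill₁ D X → Overlap T' X T A
    nested : (K : Ctx) → T ≡ T' ⊚ K → X ≡ K [ η A ] → Overlap T' X T A

  overlapView : ∀ T' X T A → T' [ X ] ≡ T [ η A ] → Overlap T' X T A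
  overlapView ∙ X T A eq = nested T refl eq
  overlapView (T' ◂ V) X ∙ A ()
  overlapView (T' ◂ V) X (T ◂ V') A eq with ,,-injective eq
  ... | eq₁ , refl with overlapView T' X T A eq₁
  ...   | disjoint D p q = disjoint (D ◂₂ V) (cong (_◂ V) p) (cong (_◂ V) q)
  ...   | nested K p q = nested K (cong (_◂ V) p) q
  overlapView (T' ◂ V) X (V' ▸ T) A eq with ,,-injective eq
  ... | refl , eq₂ = disjoint (T' ,₁₂ T) (cong (T' ◂_) eq₂) refl
  overlapView (V ▸ T') X ∙ A ()
  overlapView (V ▸ T') X (V' ▸ T) A eq with ,,-injective eq
  ... | refl , eq₂ with overlapView T' X T A eq₂
  ...   | disjoint D p q = disjoint (V ▸₂ D) (cong (V ▸_) p) (cong (V ▸_) q)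
  ...   | nested K p q = nested K (cong (V ▸_) p) q
  overlapView (V ▸ T') X (T ◂ V') A eq with ,,-injective eq
  ... | eq₁ , refl = disjoint (T ,₂₁ T') (cong (_▸ T') eq₁) refl

  LocalRule : Tree → Tree → Set
  LocalRule X' X = ∀ T {C} → T [ X' ] ⊢ C → T [ X ] ⊢ C

  inside : ∀ {X' X} → LocalRule X' X → ∀ K → LocalRule (K [ X' ]) (K [ X ])
  inside {X'} {X} rule K T d =
    subst⊢ (⊚-[] T K X) (rule (T ⊚ K) (subst⊢ (sym (⊚-[] T K X')) d))

  beside : ∀ {X' X U C} → LocalRule X' X → ∀ D → fill₁ D X' [ U ] ⊢ C → fill₁ D X [ U ] ⊢ C
  beside {X'} {X} {U} rule D d =
    subst⊢ (fill-comm D X U) (rule (fill₂ D U) (subst⊢ (sym (fill-comm D X' U)) d))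

  data RightIntro : Tree → Fma → Set where
    IR : RightIntro ─ I
    ⊗R : ∀ {T U A B} → T ⊢ A → U ⊢ B → RightIntro (T ,, U) (A ⊗ B)
    ⊸R : ∀ {T A B} → T ,, η A ⊢ B → RightIntro T (A ⊸ B)

  derivation : ∀ {U A} → RightIntro U A → U ⊢ A
  derivation IR = IR
  derivation (⊗R f g) = ⊗R f g
  derivation (⊸R f) = ⊸R f

  Cut : Fma → Set
  Cut A = ∀ {U T C} → U ⊢ A → T [ η A ] ⊢ C → T [ U ] ⊢ C

  CutsBelow : Fma → Set
  CutsBelow (A ⊗ B) = Cut A × Cut B
  CutsBelow (A ⊸ B) = Cut A × Cut B
  CutsBelow _ = ⊤

  cut-∘ : ∀ {A U T K C} → Cut A → U ⊢ A → T [ K [ η A ] ] ⊢ C → T [ K [ U ] ] ⊢ C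
  cut-∘ {A} {U} {T} {K} cutA f g =
    subst⊢ (⊚-[] T K U) (cutA f (subst⊢ (sym (⊚-[] T K (η A))) g))

  principal-I : ∀ {U T C} → RightIntro U I → T [ ─ ] ⊢ C → T [ U ] ⊢ C
  principal-I IR g = g

  principal-⊗ : ∀ {A B U T C} → CutsBelow (A ⊗ B) → RightIntro U (A ⊗ B)
              → T [ η A ,, η B ] ⊢ C → T [ U ] ⊢ C
  principal-⊗ {B = B} (cutA , cutB) (⊗R {T = U₁} f₁ f₂) g =
    cut-∘ {K = U₁ ▸ ∙} cutB f₂ (cut-∘ {K = ∙ ◂ η B} cutA f₁ g)

  principal-⊸ : ∀ {A B U V T C} → CutsBelow (A ⊸ B) → RightIntro U (A ⊸ B)
              → V ⊢ A → T [ η B ] ⊢ C → T [ U ,, V ] ⊢ C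
  principal-⊸ {U = U} (cutA , cutB) (⊸R f) h k = cutB (cutA {T = U ▸ ∙} h f) k

  module CutRightIntro {A U} (below : CutsBelow A) (r : RightIntro U A) where
    mutual
      -- The index equation is explicit because T [ η A ] is not a pattern one can match against.
      cutAt : ∀ {W C} → W ⊢ C → ∀ T → W ≡ T [ η A ] → T [ U ] ⊢ C
      cutAt ax ∙ refl = derivation r
      cutAt ax (T ◂ V) ()
      cutAt ax (V ▸ T) ()
      cutAt IR ∙ ()
      cutAt IR (T ◂ V) ()
      cutAt IR (V ▸ T) ()
      cutAt (⊗R g₁ g₂) ∙ ()
      cutAt (⊗R g₁ g₂) (T ◂ V) refl = ⊗R (cutAt g₁ T refl) g₂
      cutAt (⊗R g₁ g₂) (V ▸ T) refl = ⊗R g₁ (cutAt g₂ T refl)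
      cutAt (⊸R {A = A'} g) T refl = ⊸R (cutAt g (T ◂ η A') refl)
      cutAt (IL g) = cutThrough (λ T → IL {T}) g (λ K e → IL-active K e g)
      cutAt (⊗L g) = cutThrough (λ T → ⊗L {T}) g (λ K e → ⊗L-active K e g)
      cutAt (⊸L h k) = cutThrough (λ T → ⊸L {T} h) k (λ K e → ⊸L-active K e h k)
      cutAt (assoc g) = cutThrough (λ T → assoc {T}) g (λ K e → assoc-active K e g)
      cutAt (unitL g) = cutThrough (λ T → unitL {T}) g (λ K e → unitL-active K e g)
      cutAt (unitR g) = cutThrough (λ T → unitR {T}) g (λ K e → unitR-active K e g)

      cutAt-∘ : ∀ {C} T K → T [ K [ η A ] ] ⊢ C → T [ K [ U ] ] ⊢ C
      cutAt-∘ T K g = subst⊢ (⊚-[] T K U) (cutAt g (T ⊚ K) (sym (⊚-[] T K (η A))))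

      cutThrough : ∀ {T' X' X C} → LocalRule X' X → T' [ X' ] ⊢ C
                 → (∀ K → X ≡ K [ η A ] → T' [ K [ U ] ] ⊢ C)
                 → ∀ T → T' [ X ] ≡ T [ η A ] → T [ U ] ⊢ C
      cutThrough {T'} {X'} {X} rule g active T eq with overlapView T' X T A eq
      ... | disjoint D refl refl = beside rule D (cutAt g (fill₁ D X') (fill-comm D X' (η A)))
      ... | nested K refl e = subst⊢ (sym (⊚-[] T' K U)) (active K e)

      IL-active : ∀ {T C} K → η I ≡ K [ η A ] → T [ ─ ] ⊢ C → T [ K [ U ] ] ⊢ C
      IL-active ∙ refl g = principal-I r g
      IL-active (K ◂ V) ()
      IL-active (V ▸ K) ()

      ⊗L-active : ∀ {T A₁ B₁ C} K → η (A₁ ⊗ B₁) ≡ K [ η A ]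
                → T [ η A₁ ,, η B₁ ] ⊢ C → T [ K [ U ] ] ⊢ C
      ⊗L-active ∙ refl g = principal-⊗ below r g
      ⊗L-active (K ◂ V) ()
      ⊗L-active (V ▸ K) ()

      ⊸L-active : ∀ {T A₁ B₁ V C} K → η (A₁ ⊸ B₁) ,, V ≡ K [ η A ]
                → V ⊢ A₁ → T [ η B₁ ] ⊢ C → T [ K [ U ] ] ⊢ C
      ⊸L-active ∙ ()
      ⊸L-active (∙ ◂ _) refl h k = principal-⊸ below r h k
      ⊸L-active ((K ◂ W) ◂ V) ()
      ⊸L-active ((W ▸ K) ◂ V) ()
      ⊸L-active {T} (_ ▸ K) refl h k = ⊸L {T} (cutAt h K refl) k

      assoc-active : ∀ {T U₀ U₁ U₂ C} K → (U₀ ,, U₁) ,, U₂ ≡ K [ η A ]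
                   → T [ U₀ ,, (U₁ ,, U₂) ] ⊢ C → T [ K [ U ] ] ⊢ C
      assoc-active ∙ ()
      assoc-active (∙ ◂ V) ()
      assoc-active {T} ((K ◂ U₁) ◂ U₂) refl g =
        assoc {T} (cutAt-∘ T (K ◂ (U₁ ,, U₂)) g)
      assoc-active {T} ((U₀ ▸ K) ◂ U₂) refl g =
        assoc {T} (cutAt-∘ T (U₀ ▸ (K ◂ U₂)) g)
      assoc-active {T} {U₀} {U₁} (_ ▸ K) refl g =
        assoc {T} (cutAt-∘ T (U₀ ▸ (U₁ ▸ K)) g)

      unitL-active : ∀ {T V C} K → ─ ,, V ≡ K [ η A ] → T [ V ] ⊢ C → T [ K [ U ] ] ⊢ C
      unitL-active ∙ ()
      unitL-active (∙ ◂ V) ()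
      unitL-active ((K ◂ W) ◂ V) ()
      unitL-active ((W ▸ K) ◂ V) ()
      unitL-active {T} (_ ▸ K) refl g = unitL {T} (cutAt-∘ T K g)

      unitR-active : ∀ {T V C} K → V ≡ K [ η A ] → T [ V ,, ─ ] ⊢ C → T [ K [ U ] ] ⊢ C
      unitR-active {T} K refl g = unitR {T} (cutAt-∘ T (K ◂ ─) g)

  cutRightIntro : ∀ {A U T C} → CutsBelow A → RightIntro U A → T [ η A ] ⊢ C → T [ U ] ⊢ C
  cutRightIntro {T = T} below r g = CutRightIntro.cutAt below r g T refl

  cutWith : ∀ {A} → CutsBelow A → Cut A
  cutWith below ax g = g
  cutWith below IR g = cutRightIntro below IR g
  cutWith below (⊗R f₁ f₂) g = cutRightIntro below (⊗R f₁ f₂) g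
  cutWith below (⊸R f) g = cutRightIntro below (⊸R f) g
  cutWith below {T = T} (IL {U'} f) g = inside (λ T → IL {T}) U' T (cutWith below f g)
  cutWith below {T = T} (⊗L {U'} f) g = inside (λ T → ⊗L {T}) U' T (cutWith below f g)
  cutWith below {T = T} (⊸L {U'} h f) g = inside (λ T → ⊸L {T} h) U' T (cutWith below f g)
  cutWith below {T = T} (assoc {U'} f) g = inside (λ T → assoc {T}) U' T (cutWith below f g)
  cutWith below {T = T} (unitL {U'} f) g = inside (λ T → unitL {T}) U' T (cutWith below f g)
  cutWith below {T = T} (unitR {U'} f) g = inside (λ T → unitR {T}) U' T (cutWith below f g)

  mutual
    cut : ∀ A → Cut A
    cut A = cutWith (cutsBelow A)

    cutsBelow : ∀ A → CutsBelow A
    cutsBelow (A ⊗ B) = cut A , cut B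
    cutsBelow (A ⊸ B) = cut A , cut B
    cutsBelow (` X) = tt
    cutsBelow I = tt

mainTheorem2 : (At : Set) → let open LSkT At in
    {U : Tree} {T : Ctx} {A C : Fma} → U ⊢ A → T [ η A ] ⊢ C → T [ U ] ⊢ C
mainTheorem2 At {A = A} = CutAdmissibility.cut At A
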